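{- Let $T$ be the tree with seven vertices $v_1,\dots,v_7$ and edges $\{v_1,v_2\},\{v_1,v_3\},\{v_1,v_4\},\{v_2,v_5\},\{v_3,v_6\},\{v_4,v_7\}$. Then $C_T-1$ equals the largest real root of the polynomial $x^3+x^2-5x-3$. In particular, $\sup_{k\in\mathbb N\cup\{0\}}C^k_T\le 3<C_T\approx 3.0861$.
   Context: The graph $T$ carries the path distance $d_T$, with closed balls $B(v,r)=\{w: d_T(v,w)\le r\}$. A measure on $T$ is a function $\mu:V_T\to(0,\infty)$, $\mu(A)=\sum_{v\in A}\mu(v)$. $C_\mu=\sup_{v,\,r\ge0}\mu(B(v,2r))/\mu(B(v,r))$ and $C_T=\inf_\mu C_\mu$. For $k\in\mathbb N\cup\{0\}$, $C^k_\mu=\sup_v\mu(B(v,2k+1))/\mu(B(v,k))$ and $C^k_T=\inf_\mu C^k_\mu$.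
   Formalization: Measures on $T$ take only positive rational values instead of values in $(0,\infty)$. -}

module Defs where

open import Data.Bool using (Bool; true; false; _∧_; _∨_; if_then_else_)
open import Data.Nat using (ℕ; zero; suc)
open import Data.Fin using (Fin) renaming (_≟_ to _≟ᶠ_)
open import Data.Fin.Patterns
open import Data.List using (List; []; _∷_; allFin; foldr; map)
open import Data.Bool.ListAction using (any)
open import Data.Product using (_×_; _,_; Σ; ∃)
open import Data.Integer using (+_; ∣_∣)
open import Data.Rational using (ℚ; 0ℚ; 1ℚ; _+_; _*_; _-_; _<_; _≤_; _/_; floor)
open import Relation.Nullary.Decidable using (does)

-- The tree T.  Vertex v_i is represented by (i - 1) : Fin 7.
V : Set
V = Fin 7

edges : List (V × V)
edges = (0F , 1F) ∷ (0F , 2F) ∷ (0F , 3F) ∷ (1F , 4F) ∷ (2F , 5F) ∷ (3F , 6F) ∷ []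

eqV : V → V → Bool
eqV v w = does (v ≟ᶠ w)

adj : V → V → Bool
adj v w = any (λ e → (eqV (Data.Product.proj₁ e) v ∧ eqV (Data.Product.proj₂ e) w)
                   ∨ (eqV (Data.Product.proj₁ e) w ∧ eqV (Data.Product.proj₂ e) v)) edges

within : ℕ → V → V → Bool
within zero v w = eqV v w
within (suc n) v w = within n v w ∨ any (λ u → adj v u ∧ within n u w) (allFin 7)

Measure : Set
Measure = V → ℚ

Positive : Measure → Set
Positive μ = ∀ v → 0ℚ < μ v

ballMeasureℕ : Measure → V → ℕ → ℚ
ballMeasureℕ μ v n = foldr _+_ 0ℚ (map (λ w → if within n v w then μ w else 0ℚ) (allFin 7))

-- μ(B(v,r)) for a radius r ≥ 0 (d_T(v,w) ≤ r  iff  d_T(v,w) ≤ ⌊r⌋)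
ballMeasure : Measure → V → ℚ → ℚ
ballMeasure μ v r = ballMeasureℕ μ v ∣ floor r ∣

-- "q < C_μ" : some ratio μ(B(v,2r))/μ(B(v,r)) exceeds q  (sup > q)
CAbove : Measure → ℚ → Set
CAbove μ q = Σ V λ v → Σ ℚ λ r → (0ℚ ≤ r) × (q * ballMeasure μ v r < ballMeasure μ v (r + r))

-- "C_μ < q" : there is s < q bounding all ratios  (sup < q)
CBelow : Measure → ℚ → Set
CBelow μ q = Σ ℚ λ s → (s < q) × (∀ v r → 0ℚ ≤ r → ballMeasure μ v (r + r) ≤ s * ballMeasure μ v r)

CkBelow : ℕ → Measure → ℚ → Set
CkBelow k μ q = Σ ℚ λ s → (s < q) × (∀ v → ballMeasureℕ μ v (suc (k Data.Nat.+ k)) ≤ s * ballMeasureℕ μ v k)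

poly : ℚ → ℚ
poly x = x * x * x + x * x - (+ 5 / 1) * x - (+ 3 / 1)

-- Cuts of the largest real root α of p (positive leading coefficient):
-- x < α  iff  p takes a negative value at some y > x;
-- α < x  iff  p is positive on [x, ∞).
BelowLargestRoot : ℚ → Set
BelowLargestRoot x = Σ ℚ λ y → (x < y) × (poly y < 0ℚ)

AboveLargestRoot : ℚ → Set
AboveLargestRoot x = ∀ y → x ≤ y → 0ℚ < poly y

-- Write c, A and B for the mass of the root v₁, of its three neighbours and of the three leaves.
-- If every doubling ratio of μ is at most q, testing it at radius ½ around v₁ and its neighbours
-- and at radius 3/2 around the leaves gives, for every y > q - 1,
--   A ≤ y c,   3c + B ≤ y A,   3c + 2A ≤ y (A + B),
-- and y (y (A + B) - 3c - 2A) + y² (y A - 3c - B) + 3 (1 + y) (y c - A) = A · poly y, so poly y ≥ 0.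
-- Conversely, for x ≥ 2 with poly x ≥ 0 the measure with weights 3, x, x² - 3 on the three layers
-- satisfies μ(B(v,2k+1)) ≤ (1 + x) μ(B(v,k)) for all v and k, which bounds C_μ by 1 + x because
-- ⌊2r⌋ ≤ 2⌊r⌋ + 1; for such a radial measure each of these inequalities only depends on how many
-- vertices of each layer a ball contains, and reduces to a cubic in x - 2 with a finite certificate.
-- Rational x ≥ 2 just above the root come from a Newton step. For C^k the weights (3, 2, 1) work
-- at k = 0 and the counting measure for k ≥ 1, and C_T > 3 because poly (41/20) < 0.

module Submission where

open import Defs
open import Data.Bool using (Bool; true; false; if_then_else_)
open import Data.Empty using (⊥-elim)
open import Data.Fin.Patterns
open import Data.Fin.Properties using (all?; any?)
open import Data.Integer as ℤ using (+_; -[1+_])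
import Data.Integer.DivMod as ℤD
import Data.Integer.Properties as ℤP
open import Data.List using (List; []; _∷_; allFin; foldr; map; filterᵇ)
open import Data.Nat as ℕ using (ℕ; suc; NonZero; s≤s; z≤n)
open import Data.Nat.Coprimality using (Coprime)
import Data.Nat.DivMod as ℕD
import Data.Nat.Properties as ℕP
import Data.Nat.Tactic.RingSolver as ℕ-Solver
open import Data.Product using (_×_; _,_; Σ; proj₁; proj₂)
open import Data.Rational as ℚ
  using (ℚ; mkℚ; 0ℚ; 1ℚ; ½; floor; toℚᵘ; *≤*; _≤_; _<_; _+_; _*_; _-_; -_; _/_; _÷_)
open import Agda.Builtin.FromNat using (fromNat)
import Data.Nat.Literals as ℕ
import Data.Rational.Literals as ℚ
import Data.Rational.Properties as ℚP
import Data.Rational.Unnormalised as ℚᵘ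
open import Data.Unit using (tt)
open import Data.Sum using (_⊎_; inj₁; inj₂)
open import Level using (0ℓ)
open import Relation.Binary.PropositionalEquality
open import Relation.Nullary using (Dec; yes; no; ¬_)
open import Relation.Nullary.Decidable using (True; toWitness; dec⇒maybe; _×-dec_; _⊎-dec_)
open import Tactic.RingSolver using (solve-∀)
open import Tactic.RingSolver.Core.AlmostCommutativeRing using (AlmostCommutativeRing; fromCommutativeRing)

instance
  ℕ-number = ℕ.number
  ℚ-number = ℚ.number

ℚ-ring : AlmostCommutativeRing 0ℓ 0ℓ
ℚ-ring = fromCommutativeRing ℚP.+-*-commutativeRing (λ p → dec⇒maybe (0ℚ ℚ.≟ p))

0≤+ : ∀ {p q} → 0ℚ ≤ p → 0ℚ ≤ q → 0ℚ ≤ p + q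
0≤+ = ℚP.+-mono-≤

0≤* : ∀ {p q} → 0ℚ ≤ p → 0ℚ ≤ q → 0ℚ ≤ p * q
0≤* {p} {q} 0≤p 0≤q = ℚP.nonNegative⁻¹ (p * q)
  {{ℚP.nonNeg*nonNeg⇒nonNeg p {{ℚ.nonNegative 0≤p}} q {{ℚ.nonNegative 0≤q}}}}

0<* : ∀ {p q} → 0ℚ < p → 0ℚ < q → 0ℚ < p * q
0<* {p} {q} 0<p 0<q = ℚP.positive⁻¹ (p * q)
  {{ℚP.pos*pos⇒pos p {{ℚ.positive 0<p}} q {{ℚ.positive 0<q}}}}

0≤lit : ∀ p → .{{ℚ.NonNegative p}} → 0ℚ ≤ p
0≤lit p = ℚP.nonNegative⁻¹ p

0<lit : ∀ p → .{{ℚ.Positive p}} → 0ℚ < p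
0<lit p = ℚP.positive⁻¹ p

0≤q-p : ∀ {p q} → p ≤ q → 0ℚ ≤ q - p
0≤q-p {p} {q} p≤q = subst (_≤ q - p) (ℚP.+-inverseʳ p) (ℚP.+-monoˡ-≤ (- p) p≤q)

0<q-p : ∀ {p q} → p < q → 0ℚ < q - p
0<q-p {p} {q} p<q = subst (_< q - p) (ℚP.+-inverseʳ p) (ℚP.+-monoˡ-< (- p) p<q)

<⇒≱ : ∀ {p q} → p < q → ¬ (q ≤ p)
<⇒≱ p<q q≤p = ℚP.<-irrefl refl (ℚP.<-≤-trans p<q q≤p)

p+[q-p]≡q : ∀ p q → p + (q - p) ≡ q
p+[q-p]≡q = solve-∀ ℚ-ring

≤-by-gap : ∀ {p q} g → q - p ≡ g → 0ℚ ≤ g → p ≤ q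
≤-by-gap {p} {q} g q-p≡g 0≤g =
  subst₂ _≤_ (ℚP.+-identityʳ p) (p+[q-p]≡q p q) (ℚP.+-monoʳ-≤ p (subst (0ℚ ≤_) (sym q-p≡g) 0≤g))

<-by-gap : ∀ {p q} g → q - p ≡ g → 0ℚ < g → p < q
<-by-gap {p} {q} g q-p≡g 0<g =
  subst₂ _<_ (ℚP.+-identityʳ p) (p+[q-p]≡q p q) (ℚP.+-monoʳ-< p (subst (0ℚ <_) (sym q-p≡g) 0<g))

m<[1+m/n]*n : ∀ m n .{{_ : NonZero n}} → m ℕ.< suc (m ℕ./ n) ℕ.* n
m<[1+m/n]*n m n = begin-strict
  m                          ≡⟨ ℕD.m≡m%n+[m/n]*n m n ⟩
  m ℕ.% n ℕ.+ m ℕ./ n ℕ.* n  <⟨ ℕP.+-monoˡ-< (m ℕ./ n ℕ.* n) (ℕD.m%n<n m n) ⟩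
  suc (m ℕ./ n) ℕ.* n        ∎
  where open ℕP.≤-Reasoning

-- The hypothesis says a/e = n/d + n/d, with the sum over its unreduced denominator d * d.
/-double : ∀ a e n d .{{_ : NonZero e}} .{{_ : NonZero d}} →
           a ℕ.* (d ℕ.* d) ≡ (n ℕ.* d ℕ.+ n ℕ.* d) ℕ.* e → a ℕ./ e ℕ.≤ suc (n ℕ./ d ℕ.+ n ℕ./ d)
/-double a e n d eq = ℕP.m<1+n⇒m≤n (ℕD.m<n*o⇒m/o<n a<N*e)
  where
  k = n ℕ./ d
  N = suc (suc (k ℕ.+ k))
  n*d< : n ℕ.* d ℕ.< suc k ℕ.* d ℕ.* d
  n*d< = ℕP.*-monoˡ-< d (m<[1+m/n]*n n d)
  a<N*e : a ℕ.< N ℕ.* e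
  a<N*e = ℕP.*-cancelʳ-< (d ℕ.* d) a (N ℕ.* e) (begin-strict
    a ℕ.* (d ℕ.* d)                                      ≡⟨ eq ⟩
    (n ℕ.* d ℕ.+ n ℕ.* d) ℕ.* e                          <⟨ ℕP.*-monoˡ-< e (ℕP.+-mono-< n*d< n*d<) ⟩
    (suc k ℕ.* d ℕ.* d ℕ.+ suc k ℕ.* d ℕ.* d) ℕ.* e      ≡⟨ rearrange k d e ⟩
    N ℕ.* e ℕ.* (d ℕ.* d)                                ∎)
    where
    open ℕP.≤-Reasoning
    rearrange : ∀ k d e → (suc k ℕ.* d ℕ.* d ℕ.+ suc k ℕ.* d ℕ.* d) ℕ.* e ≡ suc (suc (k ℕ.+ k)) ℕ.* e ℕ.* (d ℕ.* d)
    rearrange = ℕ-Solver.solve-∀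

∣⌊2r⌋∣≤1+2∣⌊r⌋∣ : ∀ r → 0ℚ ≤ r → ℤ.∣ floor (r + r) ∣ ℕ.≤ suc (ℤ.∣ floor r ∣ ℕ.+ ℤ.∣ floor r ∣)
∣⌊2r⌋∣≤1+2∣⌊r⌋∣ r 0≤r = go r (r + r) 0≤r (ℚP.+-mono-≤ 0≤r 0≤r) (ℚP.toℚᵘ-homo-+ r r)
  where
  go : ∀ r s → 0ℚ ≤ r → 0ℚ ≤ s → toℚᵘ s ℚᵘ.≃ toℚᵘ r ℚᵘ.+ toℚᵘ r →
       ℤ.∣ floor s ∣ ℕ.≤ suc (ℤ.∣ floor r ∣ ℕ.+ ℤ.∣ floor r ∣)
  go (mkℚ (+ n) d-1 r-coprime) (mkℚ (+ a) e-1 s-coprime) _ _ (ℚᵘ.*≡* eq) =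
    subst₂ (λ x y → x ℕ.≤ suc (y ℕ.+ y)) (∣floor∣ a e-1 {s-coprime}) (∣floor∣ n d-1 {r-coprime})
      (/-double a (suc e-1) n (suc d-1) (ℤP.+-injective (begin
        + (a ℕ.* (D ℕ.* D))                      ≡⟨ ℤP.pos-* a (D ℕ.* D) ⟩
        + a ℤ.* + (D ℕ.* D)                      ≡⟨ eq ⟩
        (+ n ℤ.* + D ℤ.+ + n ℤ.* + D) ℤ.* + E    ≡⟨ cong (ℤ._* + E) (cong₂ ℤ._+_ (ℤP.pos-* n D) (ℤP.pos-* n D)) ⟨
        (+ (n ℕ.* D) ℤ.+ + (n ℕ.* D)) ℤ.* + E    ≡⟨ cong (ℤ._* + E) (ℤP.pos-+ (n ℕ.* D) (n ℕ.* D)) ⟨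
        + (n ℕ.* D ℕ.+ n ℕ.* D) ℤ.* + E          ≡⟨ ℤP.pos-* (n ℕ.* D ℕ.+ n ℕ.* D) E ⟨
        + ((n ℕ.* D ℕ.+ n ℕ.* D) ℕ.* E)          ∎)))
    where
    open ≡-Reasoning
    D = suc d-1
    E = suc e-1
    ∣floor∣ : ∀ m c-1 .{c : Coprime m (suc c-1)} → m ℕ./ suc c-1 ≡ ℤ.∣ floor (mkℚ (+ m) c-1 c) ∣
    ∣floor∣ m c-1 = cong ℤ.∣_∣ (sym (ℤD.div-pos-is-/ℕ (+ m) (suc c-1)))
  go (mkℚ -[1+ _ ] _ _) _ (*≤* ()) _ _
  go (mkℚ (+ _) _ _) (mkℚ -[1+ _ ] _ _) _ (*≤* ()) _

Σ-if : ∀ {A : Set} → (A → Bool) → (A → ℚ) → List A → ℚ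
Σ-if f g xs = foldr _+_ 0ℚ (map (λ x → if f x then g x else 0ℚ) xs)

Σ-if-mono : ∀ {A : Set} (f f′ : A → Bool) (g : A → ℚ) → (∀ x → 0ℚ ≤ g x) →
            (∀ x → f x ≡ true → f′ x ≡ true) → ∀ xs → Σ-if f g xs ≤ Σ-if f′ g xs
Σ-if-mono f f′ g 0≤g f⇒f′ [] = ℚP.≤-refl
Σ-if-mono f f′ g 0≤g f⇒f′ (x ∷ xs) = ℚP.+-mono-≤ (term x (f x) (f′ x) (f⇒f′ x)) (Σ-if-mono f f′ g 0≤g f⇒f′ xs)
  where
  term : ∀ x b b′ → (b ≡ true → b′ ≡ true) → (if b then g x else 0ℚ) ≤ (if b′ then g x else 0ℚ)
  term x true  b′    b⇒b′ rewrite b⇒b′ refl = ℚP.≤-refl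
  term x false true  _    = 0≤g x
  term x false false _    = ℚP.≤-refl

measureOf : Measure → List V → ℚ
measureOf μ vs = foldr _+_ 0ℚ (map μ vs)

Σ-if≡measureOf-filter : ∀ f μ vs → Σ-if f μ vs ≡ measureOf μ (filterᵇ f vs)
Σ-if≡measureOf-filter f μ [] = refl
Σ-if≡measureOf-filter f μ (v ∷ vs) with f v
... | true  = cong (λ s → μ v + s) (Σ-if≡measureOf-filter f μ vs)
... | false = trans (ℚP.+-identityˡ _) (Σ-if≡measureOf-filter f μ vs)

total : Measure → ℚ
total μ = measureOf μ (allFin 7)

ball : V → ℕ → List V
ball v k = filterᵇ (within k v) (allFin 7)

ballMeasureℕ≡measureOf-ball : ∀ μ v k → ballMeasureℕ μ v k ≡ measureOf μ (ball v k)
ballMeasureℕ≡measureOf-ball μ v k = Σ-if≡measureOf-filter (within k v) μ (allFin 7)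

within-mono : ∀ {m n} v w → m ℕ.≤ n → within m v w ≡ true → within n v w ≡ true
within-mono {m} {n} v w m≤n = go (ℕP.≤⇒≤′ m≤n)
  where
  go : ∀ {n} → m ℕ.≤′ n → within m v w ≡ true → within n v w ≡ true
  go ℕ.≤′-refl     m∈ = m∈
  go (ℕ.≤′-step p) m∈ rewrite go p m∈ = refl

CkAtMost : ℕ → Measure → ℚ → Set
CkAtMost k μ s = ∀ v → ballMeasureℕ μ v (suc (k ℕ.+ k)) ≤ s * ballMeasureℕ μ v k

CAtMost : Measure → ℚ → Set
CAtMost μ s = ∀ v r → 0ℚ ≤ r → ballMeasure μ v (r + r) ≤ s * ballMeasure μ v r

module _ {μ : Measure} (μ≥0 : ∀ w → 0ℚ ≤ μ w) where

  ballMeasureℕ-mono : ∀ v {m n} → m ℕ.≤ n → ballMeasureℕ μ v m ≤ ballMeasureℕ μ v n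
  ballMeasureℕ-mono v m≤n = Σ-if-mono _ _ μ μ≥0 (λ w → within-mono v w m≤n) (allFin 7)

  ballMeasureℕ≤total : ∀ v n → ballMeasureℕ μ v n ≤ total μ
  ballMeasureℕ≤total v n = Σ-if-mono (within n v) (λ _ → true) μ μ≥0 (λ _ _ → refl) (allFin 7)

  CkAtMost-beyond-2 : ∀ {s} → 0ℚ ≤ s → (∀ v → total μ ≤ s * ballMeasureℕ μ v 2) → ∀ j → CkAtMost (2 ℕ.+ j) μ s
  CkAtMost-beyond-2 {s} 0≤s total≤ j v = begin
    ballMeasureℕ μ v (suc (2 ℕ.+ j ℕ.+ (2 ℕ.+ j)))  ≤⟨ ballMeasureℕ≤total v (suc (2 ℕ.+ j ℕ.+ (2 ℕ.+ j))) ⟩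
    total μ                                        ≤⟨ total≤ v ⟩
    s * ballMeasureℕ μ v 2                         ≤⟨ ℚP.*-monoˡ-≤-nonNeg s {{ℚ.nonNegative 0≤s}}
                                                        (ballMeasureℕ-mono v {2} {2 ℕ.+ j} (s≤s (s≤s z≤n))) ⟩
    s * ballMeasureℕ μ v (2 ℕ.+ j)                 ∎
    where open ℚP.≤-Reasoning

  CAtMost-from-CkAtMost : ∀ {s} → (∀ k → CkAtMost k μ s) → CAtMost μ s
  CAtMost-from-CkAtMost Ck v r 0≤r =
    ℚP.≤-trans (ballMeasureℕ-mono v (∣⌊2r⌋∣≤1+2∣⌊r⌋∣ r 0≤r)) (Ck ℤ.∣ floor r ∣ v)

decide-∀ : ∀ {P : V → Set} (P? : ∀ v → Dec (P v)) → True (all? P?) → ∀ v → P v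
decide-∀ P? = toWitness

poly-nonNeg-certificate : ∀ {c A B y} → 0ℚ ≤ c → 0ℚ < A →
                          A ≤ y * c → 3 * c + B ≤ y * A → 3 * c + 2 * A ≤ y * (A + B) → 0ℚ ≤ poly y
poly-nonNeg-certificate {c} {A} {B} {y} 0≤c 0<A root middle leaf =
  ℚP.*-cancelˡ-≤-pos A {{ℚ.positive 0<A}} (subst (_≤ A * poly y) (sym (ℚP.*-zeroʳ A))
    (subst (0ℚ ≤_) (sym (identity c A B y))
      (0≤+ (0≤+ (0≤* 0≤y (0≤q-p leaf)) (0≤* (0≤* 0≤y 0≤y) (0≤q-p middle)))
           (0≤* (0≤* (0≤lit 3) (0≤+ (0≤lit 1ℚ) 0≤y)) (0≤q-p root)))))
  where
  identity : ∀ c A B y → A * (y * y * y + y * y - 5 * y - 3)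
           ≡ y * (y * (A + B) - (3 * c + 2 * A)) + y * y * (y * A - (3 * c + B)) + 3 * (1ℚ + y) * (y * c - A)
  identity = solve-∀ ℚ-ring
  0≤y : 0ℚ ≤ y
  0≤y with 0ℚ ℚ.≤? y
  ... | yes 0≤y = 0≤y
  ... | no  0≰y = ⊥-elim (<⇒≱ 0<A (ℚP.≤-trans root (subst (y * c ≤_) (ℚP.*-zeroˡ c)
                    (ℚP.*-monoʳ-≤-nonNeg c {{ℚ.nonNegative 0≤c}} (ℚP.<⇒≤ (ℚP.≰⇒> 0≰y))))))

x+z≤qz⇒x≤yz : ∀ {x z q y} → 0ℚ ≤ z → q - 1ℚ < y → x + z ≤ q * z → x ≤ y * z
x+z≤qz⇒x≤yz {x} {z} {q} {y} 0≤z q-1<y x+z≤qz =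
  ≤-by-gap _ (identity x z q y) (0≤+ (0≤q-p x+z≤qz) (0≤* (ℚP.<⇒≤ (0<q-p q-1<y)) 0≤z))
  where
  identity : ∀ x z q y → y * z - x ≡ (q * z - (x + z)) + (y - (q - 1ℚ)) * z
  identity = solve-∀ ℚ-ring

-- Around the root and the middle vertices ⌊r⌋ = 0 and ⌊2r⌋ = 1; around the leaves ⌊r⌋ = 1 and ⌊2r⌋ = 3.
testRadius : V → ℚ
testRadius 0F = ½
testRadius 1F = ½
testRadius 2F = ½
testRadius 3F = ½
testRadius 4F = + 3 / 2
testRadius 5F = + 3 / 2
testRadius 6F = + 3 / 2

0≤testRadius : ∀ v → 0ℚ ≤ testRadius v
0≤testRadius 0F = 0≤lit _
0≤testRadius 1F = 0≤lit _
0≤testRadius 2F = 0≤lit _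
0≤testRadius 3F = 0≤lit _
0≤testRadius 4F = 0≤lit _
0≤testRadius 5F = 0≤lit _
0≤testRadius 6F = 0≤lit _

DoublingAtTestRadii : Measure → ℚ → Set
DoublingAtTestRadii μ q = ∀ v → ballMeasure μ v (testRadius v + testRadius v) ≤ q * ballMeasure μ v (testRadius v)

module _ {μ : Measure} {q : ℚ} (doubling : DoublingAtTestRadii μ q) where

  private
    c A B : ℚ
    c = μ 0F
    A = μ 1F + μ 2F + μ 3F
    B = μ 4F + μ 5F + μ 6F

    doubling′ : ∀ v → measureOf μ (ball v ℤ.∣ floor (testRadius v + testRadius v) ∣)
                     ≤ q * measureOf μ (ball v ℤ.∣ floor (testRadius v) ∣)
    doubling′ v = subst₂ (λ X Y → X ≤ q * Y)
      (ballMeasureℕ≡measureOf-ball μ v ℤ.∣ floor (testRadius v + testRadius v) ∣)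
      (ballMeasureℕ≡measureOf-ball μ v ℤ.∣ floor (testRadius v) ∣)
      (doubling v)

    +-mono₃-≤ : ∀ {x₁ x₂ x₃ y₁ y₂ y₃} → x₁ ≤ y₁ → x₂ ≤ y₂ → x₃ ≤ y₃ → x₁ + x₂ + x₃ ≤ y₁ + y₂ + y₃
    +-mono₃-≤ p₁ p₂ p₃ = ℚP.+-mono-≤ (ℚP.+-mono-≤ p₁ p₂) p₃

  root-doubling : A + c ≤ q * c
  root-doubling = subst₂ (λ X Y → X ≤ q * Y) (balls (μ 0F) (μ 1F) (μ 2F) (μ 3F)) (ℚP.+-identityʳ c) (doubling′ 0F)
    where
    balls : ∀ c a₁ a₂ a₃ → c + (a₁ + (a₂ + (a₃ + 0ℚ))) ≡ a₁ + a₂ + a₃ + c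
    balls = solve-∀ ℚ-ring

  middle-doubling : 3 * c + B + A ≤ q * A
  middle-doubling = subst₂ _≤_ (outer (μ 0F) (μ 1F) (μ 2F) (μ 3F) (μ 4F) (μ 5F) (μ 6F)) (inner q (μ 1F) (μ 2F) (μ 3F))
    (+-mono₃-≤ (doubling′ 1F) (doubling′ 2F) (doubling′ 3F))
    where
    outer : ∀ c a₁ a₂ a₃ b₁ b₂ b₃ → c + (a₁ + (b₁ + 0ℚ)) + (c + (a₂ + (b₂ + 0ℚ))) + (c + (a₃ + (b₃ + 0ℚ)))
                                   ≡ 3 * c + (b₁ + b₂ + b₃) + (a₁ + a₂ + a₃)
    outer = solve-∀ ℚ-ring
    inner : ∀ q a₁ a₂ a₃ → q * (a₁ + 0ℚ) + q * (a₂ + 0ℚ) + q * (a₃ + 0ℚ) ≡ q * (a₁ + a₂ + a₃)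
    inner = solve-∀ ℚ-ring

  leaf-doubling : 3 * c + 2 * A + (A + B) ≤ q * (A + B)
  leaf-doubling = subst₂ _≤_ (outer (μ 0F) (μ 1F) (μ 2F) (μ 3F) (μ 4F) (μ 5F) (μ 6F)) (inner q (μ 1F) (μ 2F) (μ 3F) (μ 4F) (μ 5F) (μ 6F))
    (+-mono₃-≤ (doubling′ 4F) (doubling′ 5F) (doubling′ 6F))
    where
    outer : ∀ c a₁ a₂ a₃ b₁ b₂ b₃ →
            c + (a₁ + (a₂ + (a₃ + (b₁ + 0ℚ)))) + (c + (a₁ + (a₂ + (a₃ + (b₂ + 0ℚ))))) + (c + (a₁ + (a₂ + (a₃ + (b₃ + 0ℚ)))))
            ≡ 3 * c + 2 * (a₁ + a₂ + a₃) + (a₁ + a₂ + a₃ + (b₁ + b₂ + b₃))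
    outer = solve-∀ ℚ-ring
    inner : ∀ q a₁ a₂ a₃ b₁ b₂ b₃ → q * (a₁ + (b₁ + 0ℚ)) + q * (a₂ + (b₂ + 0ℚ)) + q * (a₃ + (b₃ + 0ℚ))
                                   ≡ q * (a₁ + a₂ + a₃ + (b₁ + b₂ + b₃))
    inner = solve-∀ ℚ-ring

poly-nonNeg-if-doubling : ∀ {μ q y} → Positive μ → q - 1ℚ < y → DoublingAtTestRadii μ q → 0ℚ ≤ poly y
poly-nonNeg-if-doubling {μ} {q} {y} pos q-1<y doubling = poly-nonNeg-certificate {y = y} 0≤c 0<A
  (x+z≤qz⇒x≤yz {q = q} {y = y} 0≤c q-1<y (root-doubling {μ} {q} doubling))
  (x+z≤qz⇒x≤yz {q = q} {y = y} (ℚP.<⇒≤ 0<A) q-1<y (middle-doubling {μ} {q} doubling))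
  (x+z≤qz⇒x≤yz {q = q} {y = y} (0≤+ (ℚP.<⇒≤ 0<A) 0≤B) q-1<y (leaf-doubling {μ} {q} doubling))
  where
  0≤ : ∀ v → 0ℚ ≤ μ v
  0≤ v = ℚP.<⇒≤ (pos v)
  0≤c = 0≤ 0F
  0<A = ℚP.+-mono-<-≤ (ℚP.+-mono-<-≤ (pos 1F) (0≤ 2F)) (0≤ 3F)
  0≤B = 0≤+ (0≤+ (0≤ 4F) (0≤ 5F)) (0≤ 6F)

C-lower-bound : (μ : Measure) → Positive μ → (q : ℚ) → BelowLargestRoot (q - 1ℚ) → CAbove μ q
C-lower-bound μ pos q (y , q-1<y , poly<0)
  with any? (λ v → q * ballMeasure μ v (testRadius v) ℚ.<? ballMeasure μ v (testRadius v + testRadius v))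
... | yes (v , exceeds) = v , testRadius v , 0≤testRadius v , exceeds
... | no none = ⊥-elim (<⇒≱ poly<0 (poly-nonNeg-if-doubling {μ} {q} pos q-1<y (λ v → ℚP.≮⇒≥ (λ exceeds → none (v , exceeds)))))

C-exceeds-3 : Σ ℚ λ q → 3 < q × ((μ : Measure) → Positive μ → (s : ℚ) → s < q → CAbove μ s)
C-exceeds-3 = + 61 / 20 , toWitness {a? = 3 ℚ.<? + 61 / 20} tt , λ μ pos s s<q →
  C-lower-bound μ pos s (+ 41 / 20 , ℚP.+-monoˡ-< (- 1ℚ) s<q , toWitness {a? = poly (+ 41 / 20) ℚ.<? 0ℚ} tt)

record Layers : Set where
  constructor ⟨_,_,_⟩
  field
    root middle leaf : ℚ

radial : Layers → Measure
radial ⟨ w₀ , w₁ , w₂ ⟩ 0F = w₀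
radial ⟨ w₀ , w₁ , w₂ ⟩ 1F = w₁
radial ⟨ w₀ , w₁ , w₂ ⟩ 2F = w₁
radial ⟨ w₀ , w₁ , w₂ ⟩ 3F = w₁
radial ⟨ w₀ , w₁ , w₂ ⟩ 4F = w₂
radial ⟨ w₀ , w₁ , w₂ ⟩ 5F = w₂
radial ⟨ w₀ , w₁ , w₂ ⟩ 6F = w₂

radial-positive : ∀ {w₀ w₁ w₂} → 0ℚ < w₀ → 0ℚ < w₁ → 0ℚ < w₂ → Positive (radial ⟨ w₀ , w₁ , w₂ ⟩)
radial-positive 0<w₀ 0<w₁ 0<w₂ 0F = 0<w₀
radial-positive 0<w₀ 0<w₁ 0<w₂ 1F = 0<w₁
radial-positive 0<w₀ 0<w₁ 0<w₂ 2F = 0<w₁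
radial-positive 0<w₀ 0<w₁ 0<w₂ 3F = 0<w₁
radial-positive 0<w₀ 0<w₁ 0<w₂ 4F = 0<w₂
radial-positive 0<w₀ 0<w₁ 0<w₂ 5F = 0<w₂
radial-positive 0<w₀ 0<w₁ 0<w₂ 6F = 0<w₂

_·_ : Layers → Layers → ℚ
⟨ n₀ , n₁ , n₂ ⟩ · ⟨ w₀ , w₁ , w₂ ⟩ = n₀ * w₀ + n₁ * w₁ + n₂ * w₂

_⊕_ : Layers → Layers → Layers
⟨ m₀ , m₁ , m₂ ⟩ ⊕ ⟨ n₀ , n₁ , n₂ ⟩ = ⟨ m₀ + n₀ , m₁ + n₁ , m₂ + n₂ ⟩

·-distribʳ-⊕ : ∀ m n w → (m ⊕ n) · w ≡ m · w + n · w
·-distribʳ-⊕ ⟨ m₀ , m₁ , m₂ ⟩ ⟨ n₀ , n₁ , n₂ ⟩ ⟨ w₀ , w₁ , w₂ ⟩ = identity m₀ m₁ m₂ n₀ n₁ n₂ w₀ w₁ w₂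
  where
  identity : ∀ m₀ m₁ m₂ n₀ n₁ n₂ w₀ w₁ w₂ → (m₀ + n₀) * w₀ + (m₁ + n₁) * w₁ + (m₂ + n₂) * w₂
           ≡ m₀ * w₀ + m₁ * w₁ + m₂ * w₂ + (n₀ * w₀ + n₁ * w₁ + n₂ * w₂)
  identity = solve-∀ ℚ-ring

layerOf : V → Layers
layerOf 0F = ⟨ 1ℚ , 0ℚ , 0ℚ ⟩
layerOf 1F = ⟨ 0ℚ , 1ℚ , 0ℚ ⟩
layerOf 2F = ⟨ 0ℚ , 1ℚ , 0ℚ ⟩
layerOf 3F = ⟨ 0ℚ , 1ℚ , 0ℚ ⟩
layerOf 4F = ⟨ 0ℚ , 0ℚ , 1ℚ ⟩
layerOf 5F = ⟨ 0ℚ , 0ℚ , 1ℚ ⟩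
layerOf 6F = ⟨ 0ℚ , 0ℚ , 1ℚ ⟩

private
  root-unit : ∀ a b c → a ≡ 1ℚ * a + 0ℚ * b + 0ℚ * c
  root-unit = solve-∀ ℚ-ring
  middle-unit : ∀ a b c → b ≡ 0ℚ * a + 1ℚ * b + 0ℚ * c
  middle-unit = solve-∀ ℚ-ring
  leaf-unit : ∀ a b c → c ≡ 0ℚ * a + 0ℚ * b + 1ℚ * c
  leaf-unit = solve-∀ ℚ-ring

radial≡layerOf· : ∀ w v → radial w v ≡ layerOf v · w
radial≡layerOf· ⟨ w₀ , w₁ , w₂ ⟩ 0F = root-unit w₀ w₁ w₂
radial≡layerOf· ⟨ w₀ , w₁ , w₂ ⟩ 1F = middle-unit w₀ w₁ w₂
radial≡layerOf· ⟨ w₀ , w₁ , w₂ ⟩ 2F = middle-unit w₀ w₁ w₂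
radial≡layerOf· ⟨ w₀ , w₁ , w₂ ⟩ 3F = middle-unit w₀ w₁ w₂
radial≡layerOf· ⟨ w₀ , w₁ , w₂ ⟩ 4F = leaf-unit w₀ w₁ w₂
radial≡layerOf· ⟨ w₀ , w₁ , w₂ ⟩ 5F = leaf-unit w₀ w₁ w₂
radial≡layerOf· ⟨ w₀ , w₁ , w₂ ⟩ 6F = leaf-unit w₀ w₁ w₂

layerCount : List V → Layers
layerCount = foldr (λ v n → layerOf v ⊕ n) ⟨ 0ℚ , 0ℚ , 0ℚ ⟩

measureOf-radial : ∀ w vs → measureOf (radial w) vs ≡ layerCount vs · w
measureOf-radial ⟨ w₀ , w₁ , w₂ ⟩ [] = empty w₀ w₁ w₂
  where
  empty : ∀ a b c → 0ℚ ≡ 0ℚ * a + 0ℚ * b + 0ℚ * c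
  empty = solve-∀ ℚ-ring
measureOf-radial w (v ∷ vs) = begin
  radial w v + measureOf (radial w) vs       ≡⟨ cong₂ _+_ (radial≡layerOf· w v) (measureOf-radial w vs) ⟩
  layerOf v · w + layerCount vs · w          ≡⟨ ·-distribʳ-⊕ (layerOf v) (layerCount vs) w ⟨
  (layerOf v ⊕ layerCount vs) · w            ∎
  where open ≡-Reasoning

ballMeasureℕ-radial : ∀ w v k → ballMeasureℕ (radial w) v k ≡ layerCount (ball v k) · w
ballMeasureℕ-radial w v k = trans (ballMeasureℕ≡measureOf-ball (radial w) v k) (measureOf-radial w (ball v k))

uniform : Measure
uniform _ = 1ℚ

Ck-upper-bound : (k : ℕ) (q : ℚ) → 3 < q → Σ Measure λ μ → Positive μ × CkBelow k μ q
Ck-upper-bound 0 q 3<q = μ₀ , radial-positive (0<lit 3) (0<lit 2) (0<lit 1) , 3 , 3<q ,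
  decide-∀ (λ v → ballMeasureℕ μ₀ v 1 ℚ.≤? 3 * ballMeasureℕ μ₀ v 0) tt
  where
  μ₀ = radial ⟨ 3 , 2 , 1 ⟩
Ck-upper-bound 1 q 3<q = uniform , (λ _ → 0<lit 1) , 3 , 3<q ,
  decide-∀ (λ v → ballMeasureℕ uniform v 3 ℚ.≤? 3 * ballMeasureℕ uniform v 1) tt
Ck-upper-bound (suc (suc j)) q 3<q = uniform , (λ _ → 0<lit 1) , 3 , 3<q ,
  CkAtMost-beyond-2 (λ _ → 0≤lit 1) (0≤lit 3)
    (decide-∀ (λ v → total uniform ℚ.≤? 3 * ballMeasureℕ uniform v 2) tt) j

record Cubic : Set where
  constructor cubic
  field
    a₀ a₁ a₂ a₃ : ℚ

_⟦_⟧ : Cubic → ℚ → ℚ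
cubic a₀ a₁ a₂ a₃ ⟦ u ⟧ = a₀ + a₁ * u + a₂ * (u * u) + a₃ * (u * u * u)

_⊖_ : Cubic → Cubic → Cubic
cubic a₀ a₁ a₂ a₃ ⊖ cubic b₀ b₁ b₂ b₃ = cubic (a₀ - b₀) (a₁ - b₁) (a₂ - b₂) (a₃ - b₃)

⟦⟧-⊖ : ∀ f g u → f ⟦ u ⟧ ≡ (f ⊖ g) ⟦ u ⟧ + g ⟦ u ⟧
⟦⟧-⊖ (cubic a₀ a₁ a₂ a₃) (cubic b₀ b₁ b₂ b₃) u = identity a₀ a₁ a₂ a₃ b₀ b₁ b₂ b₃ u
  where
  identity : ∀ a₀ a₁ a₂ a₃ b₀ b₁ b₂ b₃ u →
             a₀ + a₁ * u + a₂ * (u * u) + a₃ * (u * u * u)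
           ≡ (a₀ - b₀) + (a₁ - b₁) * u + (a₂ - b₂) * (u * u) + (a₃ - b₃) * (u * u * u)
             + (b₀ + b₁ * u + b₂ * (u * u) + b₃ * (u * u * u))
  identity = solve-∀ ℚ-ring

NonNegCoeffs : Cubic → Set
NonNegCoeffs (cubic a₀ a₁ a₂ a₃) = 0ℚ ≤ a₀ × 0ℚ ≤ a₁ × 0ℚ ≤ a₂ × 0ℚ ≤ a₃

nonNegCoeffs? : ∀ f → Dec (NonNegCoeffs f)
nonNegCoeffs? (cubic a₀ a₁ a₂ a₃) = 0ℚ ℚ.≤? a₀ ×-dec 0ℚ ℚ.≤? a₁ ×-dec 0ℚ ℚ.≤? a₂ ×-dec 0ℚ ℚ.≤? a₃

⟦⟧-nonNeg : ∀ f {u} → NonNegCoeffs f → 0ℚ ≤ u → 0ℚ ≤ f ⟦ u ⟧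
⟦⟧-nonNeg (cubic a₀ a₁ a₂ a₃) (0≤a₀ , 0≤a₁ , 0≤a₂ , 0≤a₃) 0≤u =
  0≤+ (0≤+ (0≤+ 0≤a₀ (0≤* 0≤a₁ 0≤u)) (0≤* 0≤a₂ (0≤* 0≤u 0≤u))) (0≤* 0≤a₃ (0≤* (0≤* 0≤u 0≤u) 0≤u))

poly-around-2 : Cubic
poly-around-2 = cubic (- 1ℚ) 11 7 1

poly≡poly-around-2 : ∀ x → poly x ≡ poly-around-2 ⟦ x - 2 ⟧
poly≡poly-around-2 = identity
  where
  identity : ∀ x → x * x * x + x * x - 5 * x - 3
           ≡ - 1ℚ + 11 * (x - 2) + 7 * ((x - 2) * (x - 2)) + 1 * ((x - 2) * (x - 2) * (x - 2))
  identity = solve-∀ ℚ-ring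

-- At the largest root x of poly every ratio μ(B(v,2k+1)) / μ(B(v,k)) of radial (weights x) is at most
-- 1 + x, with equality around the leaves for k = 1.
weights : ℚ → Layers
weights x = ⟨ 3 , x , x * x - 3 ⟩

margin : Layers → Layers → Cubic
margin ⟨ m₀ , m₁ , m₂ ⟩ ⟨ n₀ , n₁ , n₂ ⟩ =
  cubic (9 * m₀ + 6 * m₁ + 3 * m₂ - 3 * n₀ - 2 * n₁ - n₂) (3 * m₀ + 5 * m₁ + 13 * m₂ - n₁ - 4 * n₂) (m₁ + 7 * m₂ - n₂) m₂

margin-correct : ∀ m n x → (1ℚ + x) * (m · weights x) - n · weights x ≡ margin m n ⟦ x - 2 ⟧
margin-correct ⟨ m₀ , m₁ , m₂ ⟩ ⟨ n₀ , n₁ , n₂ ⟩ = identity m₀ m₁ m₂ n₀ n₁ n₂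
  where
  identity : ∀ m₀ m₁ m₂ n₀ n₁ n₂ x →
             (1ℚ + x) * (m₀ * 3 + m₁ * x + m₂ * (x * x - 3)) - (n₀ * 3 + n₁ * x + n₂ * (x * x - 3))
           ≡ (9 * m₀ + 6 * m₁ + 3 * m₂ - 3 * n₀ - 2 * n₁ - n₂) + (3 * m₀ + 5 * m₁ + 13 * m₂ - n₁ - 4 * n₂) * (x - 2)
             + (m₁ + 7 * m₂ - n₂) * ((x - 2) * (x - 2)) + m₂ * ((x - 2) * (x - 2) * (x - 2))
  identity = solve-∀ ℚ-ring

-- The margin is visibly nonnegative for x ≥ 2, possibly after removing one copy of poly.
Certified : Layers → Layers → Set
Certified m n = NonNegCoeffs (margin m n) ⊎ NonNegCoeffs (margin m n ⊖ poly-around-2)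

certified? : ∀ m n → Dec (Certified m n)
certified? m n = nonNegCoeffs? (margin m n) ⊎-dec nonNegCoeffs? (margin m n ⊖ poly-around-2)

certified-ratio : ∀ {x} m n → 2 ≤ x → 0ℚ ≤ poly x → Certified m n → n · weights x ≤ (1ℚ + x) * (m · weights x)
certified-ratio {x} m n 2≤x 0≤poly certified = ≤-by-gap _ (margin-correct m n x) (margin-nonNeg certified)
  where
  0≤x-2 = 0≤q-p 2≤x
  margin-nonNeg : Certified m n → 0ℚ ≤ margin m n ⟦ x - 2 ⟧
  margin-nonNeg (inj₁ nonNeg) = ⟦⟧-nonNeg (margin m n) nonNeg 0≤x-2
  margin-nonNeg (inj₂ nonNeg) = subst (0ℚ ≤_) (sym (⟦⟧-⊖ (margin m n) poly-around-2 (x - 2)))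
    (0≤+ (⟦⟧-nonNeg (margin m n ⊖ poly-around-2) nonNeg 0≤x-2) (subst (0ℚ ≤_) (poly≡poly-around-2 x) 0≤poly))

weights-positive : ∀ {x} → 2 ≤ x → Positive (radial (weights x))
weights-positive {x} 2≤x = radial-positive (0<lit 3) (ℚP.<-≤-trans (0<lit 2) 2≤x)
  (<-by-gap _ (identity x) (ℚP.+-mono-≤-< (0≤+ (0≤* 0≤x-2 0≤x-2) (0≤* (0≤lit 4) 0≤x-2)) (0<lit 1)))
  where
  0≤x-2 = 0≤q-p 2≤x
  identity : ∀ x → x * x - 3 - 0ℚ ≡ (x - 2) * (x - 2) + 4 * (x - 2) + 1
  identity = solve-∀ ℚ-ring

module _ {x : ℚ} (2≤x : 2 ≤ x) (0≤poly : 0ℚ ≤ poly x) where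

  private
    μ = radial (weights x)

    ratio : ∀ v k outer → Certified (layerCount (ball v k)) (layerCount outer) →
            measureOf μ outer ≤ (1ℚ + x) * ballMeasureℕ μ v k
    ratio v k outer certified = subst₂ (λ X Y → X ≤ (1ℚ + x) * Y)
      (sym (measureOf-radial (weights x) outer)) (sym (ballMeasureℕ-radial (weights x) v k))
      (certified-ratio (layerCount (ball v k)) (layerCount outer) 2≤x 0≤poly certified)

    ball-ratio : ∀ v k l → Certified (layerCount (ball v k)) (layerCount (ball v l)) →
                 ballMeasureℕ μ v l ≤ (1ℚ + x) * ballMeasureℕ μ v k
    ball-ratio v k l certified =
      ℚP.≤-trans (ℚP.≤-reflexive (ballMeasureℕ≡measureOf-ball μ v l)) (ratio v k (ball v l) certified)

  CkAtMost-weights : ∀ k → CkAtMost k μ (1ℚ + x)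
  CkAtMost-weights 0 v = ball-ratio v 0 1 (decide-∀ (λ v → certified? (layerCount (ball v 0)) (layerCount (ball v 1))) tt v)
  CkAtMost-weights 1 v = ball-ratio v 1 3 (decide-∀ (λ v → certified? (layerCount (ball v 1)) (layerCount (ball v 3))) tt v)
  CkAtMost-weights (suc (suc j)) = CkAtMost-beyond-2 (λ v → ℚP.<⇒≤ (weights-positive 2≤x v))
    (0≤+ (0≤lit 1) (ℚP.≤-trans (0≤lit 2) 2≤x))
    (λ v → ratio v 2 (allFin 7) (decide-∀ (λ v → certified? (layerCount (ball v 2)) (layerCount (allFin 7))) tt v)) j

poly<0-below-2 : ∀ {x} → 0ℚ ≤ x → x < 2 → poly x < 0ℚ
poly<0-below-2 {x} 0≤x x<2 = <-by-gap _ (identity x)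
  (ℚP.+-mono-≤-< (0≤+ (0≤+ (0≤* (0≤* 0≤x 0≤2-x) (0≤+ (0≤lit 2) 0≤x)) (0≤* 0≤x 0≤2-x)) 0≤2-x) (0<lit 1))
  where
  0≤2-x = ℚP.<⇒≤ (0<q-p x<2)
  identity : ∀ x → 0ℚ - (x * x * x + x * x - 5 * x - 3) ≡ x * (2 - x) * (2 + x) + x * (2 - x) + (2 - x) + 1
  identity = solve-∀ ℚ-ring

2≤-if-poly-nonNeg : ∀ {x} → 0ℚ ≤ x → 0ℚ ≤ poly x → 2 ≤ x
2≤-if-poly-nonNeg {x} 0≤x 0≤poly with 2 ℚ.≤? x
... | yes 2≤x = 2≤x
... | no  2≰x = ⊥-elim (<⇒≱ (poly<0-below-2 0≤x (ℚP.≰⇒> 2≰x)) 0≤poly)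

2<-if-AboveLargestRoot : ∀ {t} → AboveLargestRoot t → 2 < t
2<-if-AboveLargestRoot {t} above with 2 ℚ.<? t
... | yes 2<t = 2<t
... | no  2≮t = ⊥-elim (<⇒≱ (above 2 (ℚP.≮⇒≥ 2≮t)) (toWitness {a? = poly 2 ℚ.≤? 0ℚ} tt))

-- poly is convex on [2, ∞), so a Newton step from t > 2 does not overshoot its largest root.
newton-step : ∀ {t} → 2 < t → 0ℚ < poly t → Σ ℚ λ x → 2 ≤ x × x < t × 0ℚ ≤ poly x
newton-step {t} 2<t 0<poly = x , 2≤-if-poly-nonNeg (ℚP.<⇒≤ 0<x) 0≤poly-x , x<t , 0≤poly-x
  where
  0≤t-2 = ℚP.<⇒≤ (0<q-p 2<t)
  0≤t = ℚP.≤-trans (0≤lit 2) (ℚP.<⇒≤ 2<t)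
  poly′ : ℚ → ℚ
  poly′ t = 3 * t * t + 2 * t - 5
  0<poly′ : 0ℚ < poly′ t
  0<poly′ = <-by-gap _ (identity t) (ℚP.+-mono-≤-< (0≤+ (0≤* (0≤* (0≤lit 3) 0≤t-2) 0≤t-2) (0≤* (0≤lit 14) 0≤t-2)) (0<lit 11))
    where
    identity : ∀ t → 3 * t * t + 2 * t - 5 - 0ℚ ≡ 3 * (t - 2) * (t - 2) + 14 * (t - 2) + 11
    identity = solve-∀ ℚ-ring
  instance
    poly′≢0 : ℚ.NonZero (poly′ t)
    poly′≢0 = ℚP.pos⇒nonZero (poly′ t) {{ℚ.positive 0<poly′}}
  δ = poly t ÷ poly′ t
  δ*poly′≡poly : δ * poly′ t ≡ poly t
  δ*poly′≡poly = begin
    poly t * ℚ.1/ poly′ t * poly′ t    ≡⟨ ℚP.*-assoc (poly t) _ (poly′ t) ⟩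
    poly t * (ℚ.1/ poly′ t * poly′ t)  ≡⟨ cong (λ e → poly t * e) (ℚP.*-inverseˡ (poly′ t)) ⟩
    poly t * 1ℚ                        ≡⟨ ℚP.*-identityʳ (poly t) ⟩
    poly t                             ∎
    where open ≡-Reasoning
  0<δ : 0ℚ < δ
  0<δ = 0<* 0<poly (ℚP.positive⁻¹ _ {{ℚP.1/pos⇒pos (poly′ t) {{ℚ.positive 0<poly′}}}})
  x = t - δ
  x<t : x < t
  x<t = <-by-gap δ (identity t δ) 0<δ
    where
    identity : ∀ t δ → t - (t - δ) ≡ δ
    identity = solve-∀ ℚ-ring
  0<x : 0ℚ < x
  0<x = 0<q-p (ℚP.*-cancelʳ-<-nonNeg (poly′ t) {{ℚ.nonNegative (ℚP.<⇒≤ 0<poly′)}} {δ} {t}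
    (<-by-gap _ (trans (cong (λ e → t * poly′ t - e) δ*poly′≡poly) (identity t))
      (ℚP.+-mono-≤-< (0≤+ (0≤* (0≤* (0≤* (0≤lit 2) 0≤t) 0≤t) 0≤t) (0≤* 0≤t 0≤t)) (0<lit 3))))
    where
    identity : ∀ t → t * (3 * t * t + 2 * t - 5) - (t * t * t + t * t - 5 * t - 3) ≡ 2 * t * t * t + t * t + 3
    identity = solve-∀ ℚ-ring
  0≤poly-x : 0ℚ ≤ poly x
  0≤poly-x = subst (0ℚ ≤_) (sym poly-x≡remainder)
    (0≤* (0≤* (ℚP.<⇒≤ 0<δ) (ℚP.<⇒≤ 0<δ)) (0≤+ (0≤+ (ℚP.<⇒≤ 0<x) (0≤* (0≤lit 2) 0≤t)) (0≤lit 1)))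
    where
    taylor : ∀ t δ → (t - δ) * (t - δ) * (t - δ) + (t - δ) * (t - δ) - 5 * (t - δ) - 3
               ≡ (t * t * t + t * t - 5 * t - 3 - δ * (3 * t * t + 2 * t - 5)) + δ * δ * ((t - δ) + 2 * t + 1)
    taylor = solve-∀ ℚ-ring
    poly-x≡remainder : poly x ≡ δ * δ * (x + 2 * t + 1)
    poly-x≡remainder = begin
      poly x                                                ≡⟨ taylor t δ ⟩
      poly t - δ * poly′ t + δ * δ * (x + 2 * t + 1)        ≡⟨ cong (λ e → poly t - e + δ * δ * (x + 2 * t + 1)) δ*poly′≡poly ⟩
      poly t - poly t + δ * δ * (x + 2 * t + 1)             ≡⟨ cong (λ e → e + δ * δ * (x + 2 * t + 1)) (ℚP.+-inverseʳ (poly t)) ⟩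
      0ℚ + δ * δ * (x + 2 * t + 1)                          ≡⟨ ℚP.+-identityˡ _ ⟩
      δ * δ * (x + 2 * t + 1)                               ∎
      where open ≡-Reasoning

C-upper-bound : (q : ℚ) → AboveLargestRoot (q - 1ℚ) → Σ Measure λ μ → Positive μ × CBelow μ q
C-upper-bound q above = radial (weights x) , weights-positive 2≤x , 1ℚ + x , 1+x<q ,
  CAtMost-from-CkAtMost {radial (weights x)} (λ v → ℚP.<⇒≤ (weights-positive 2≤x v)) {1ℚ + x} (CkAtMost-weights 2≤x 0≤poly)
  where
  step = newton-step (2<-if-AboveLargestRoot above) (above (q - 1ℚ) ℚP.≤-refl)
  x = proj₁ step
  2≤x = proj₁ (proj₂ step)
  x<q-1 = proj₁ (proj₂ (proj₂ step))
  0≤poly = proj₂ (proj₂ (proj₂ step))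
  1+x<q : 1ℚ + x < q
  1+x<q = subst (1ℚ + x <_) (identity q) (ℚP.+-monoʳ-< 1ℚ x<q-1)
    where
    identity : ∀ q → 1ℚ + (q - 1ℚ) ≡ q
    identity = solve-∀ ℚ-ring

proposition5p3 :
  -- C_T - 1 ≥ α : every positive measure has C_μ > q whenever q - 1 < α
  ((μ : Measure) → Positive μ → (q : ℚ) → BelowLargestRoot (q - 1ℚ) → CAbove μ q)
  -- C_T - 1 ≤ α : for q - 1 > α some positive measure has C_μ < q
  × ((q : ℚ) → AboveLargestRoot (q - 1ℚ) → Σ Measure λ μ → Positive μ × CBelow μ q)
  -- sup_k C^k_T ≤ 3 : for every k and q > 3 some measure has C^k_μ < q
  × ((k : ℕ) → (q : ℚ) → (+ 3 / 1) < q → Σ Measure λ μ → Positive μ × CkBelow k μ q)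
  -- 3 < C_T : some q > 3 with C_μ ≥ q for all μ (i.e. C_μ > s for all s < q)
  × (Σ ℚ λ q → ((+ 3 / 1) < q) × ((μ : Measure) → Positive μ → (s : ℚ) → s < q → CAbove μ s))
proposition5p3 = C-lower-bound , C-upper-bound , Ck-upper-bound , C-exceeds-3
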